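{- For every $n\ge 4$, the complete graph $K_n$ does not belong to $\mathcal{S}ymm$; that is, $\mathcal{B}$ has no symmetric strategy on $K_n$.
   Context: All graphs are finite simple graphs. Given a graph $G$, two players $\mathcal{A}$ and $\mathcal{B}$ alternately color edges of $G$, $\mathcal{A}$ in red and $\mathcal{B}$ in blue, with $\mathcal{A}$ moving first; in each move a player colors one so-far uncolored edge. The $i$-th round consists of the $i$-th move of $\mathcal{A}$ followed by the $i$-th move of $\mathcal{B}$. A strategy for a player is a function assigning to each sequence of the opponent's previous moves a legal (uncolored) edge to color next. Let $A_i$ (resp. $B_i$) be the set of red (resp. blue) edges colored in the first $i$ rounds. A symmetric strategy of $\mathcal{B}$ on $G$ is a strategy of $\mathcal{B}$ ensuring that, irrespective of $\mathcal{A}$'s strategy, the subgraphs with edge sets $A_i$ and $B_i$ are isomorphic for every $i\le m/2$, where $m$ is the number of edges of $G$. $\mathcal{S}ymm$ denotes the class of all graphs on which $\mathcal{B}$ has a symmetric strategy. -}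

module Defs where

open import Data.Bool using (Bool; true; false; T; not)
open import Data.Nat using (ℕ; zero; suc; _+_; _*_; _≤_; _<_)
open import Data.Fin using (Fin; toℕ)
open import Data.Fin.Properties using (_≟_)
open import Data.List using (List; []; _∷_; _++_; [_]; length; allFin; concatMap; filterᵇ)
open import Data.List.Relation.Unary.Any using (Any)
open import Data.Product using (Σ; ∃; _×_; _,_; proj₁; proj₂)
open import Data.Sum using (_⊎_)
open import Function.Bundles using (_↔_; _⇔_; Inverse)
open import Relation.Binary.PropositionalEquality using (_≡_)
open import Relation.Nullary using (¬_)
open import Relation.Nullary.Decidable using (⌊_⌋)

record Graph : Set where
  field
    n     : ℕ
    adj   : Fin n → Fin n → Bool
    adj-sym : ∀ u v → adj u v ≡ adj v u
    adj-irrefl : ∀ u → adj u u ≡ false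

open Graph public

K : ℕ → Graph
K m = record
  { n = m
  ; adj = λ u v → not ⌊ u ≟ v ⌋
  ; adj-sym = symK
  ; adj-irrefl = irreflK
  }
  where
  open import Relation.Binary.PropositionalEquality using (refl; sym)
  open import Relation.Nullary using (yes; no)
  symK : ∀ (u v : Fin m) → not ⌊ u ≟ v ⌋ ≡ not ⌊ v ≟ u ⌋
  symK u v with u ≟ v | v ≟ u
  ... | yes _ | yes _ = refl
  ... | no _  | no _  = refl
  ... | yes p | no q  = Data.Empty.⊥-elim (q (sym p))
    where import Data.Empty
  ... | no p  | yes q = Data.Empty.⊥-elim (p (sym q))
    where import Data.Empty
  irreflK : ∀ (u : Fin m) → not ⌊ u ≟ u ⌋ ≡ false
  irreflK u with u ≟ u
  ... | yes _ = refl
  ... | no p  = Data.Empty.⊥-elim (p refl)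
    where import Data.Empty

-- An edge of G: an (unordered) pair {u,v}, stored with u < v, with u,v adjacent.
Edge : Graph → Set
Edge G = Σ (Fin (n G) × Fin (n G)) λ p → (toℕ (proj₁ p) < toℕ (proj₂ p)) × T (adj G (proj₁ p) (proj₂ p))

ends : ∀ (G : Graph) → Edge G → Fin (n G) × Fin (n G)
ends G = proj₁

InE : ∀ (G : Graph) → Edge G → List (Edge G) → Set
InE G e es = Any (λ e′ → ends G e ≡ ends G e′) es

numEdges : Graph → ℕ
numEdges G = length (filterᵇ ok (concatMap (λ u → Data.List.map (λ v → (u , v)) (allFin (n G))) (allFin (n G))))
  where
  import Data.List
  ok : Fin (n G) × Fin (n G) → Bool
  ok (u , v) = ⌊ toℕ u Data.Nat.<? toℕ v ⌋ Data.Bool.∧ adj G u v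
    where import Data.Nat; import Data.Bool

Joined : ∀ (G : Graph) → List (Edge G) → Fin (n G) → Fin (n G) → Set
Joined G es u v = Any (λ e → (ends G e ≡ (u , v)) ⊎ (ends G e ≡ (v , u))) es

IsoSub : ∀ (G : Graph) → List (Edge G) → List (Edge G) → Set
IsoSub G A B = Σ (Fin (n G) ↔ Fin (n G)) λ π →
  ∀ u v → Joined G A u v ⇔ Joined G B (Inverse.to π u) (Inverse.to π v)

-- Strategy of B: given the list of A's moves so far (oldest first,
-- including A's current move), the edge B colors next.
StrategyB : Graph → Set
StrategyB G = List (Edge G) → Edge G

-- Strategy of A: given the list of B's moves so far (oldest first),
-- the edge A colors next.
StrategyA : Graph → Set
StrategyA G = List (Edge G) → Edge G

play : ∀ (G : Graph) → StrategyB G → StrategyA G → ℕ → List (Edge G) × List (Edge G)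
play G σ τ zero = [] , []
play G σ τ (suc k) =
  let as = proj₁ (play G σ τ k)
      bs = proj₂ (play G σ τ k)
      as′ = as ++ [ τ bs ]
  in as′ , bs ++ [ σ as′ ]

-- A's move in round k+1 is legal: the edge is uncolored before it.
LegalA : ∀ (G : Graph) → StrategyB G → StrategyA G → ℕ → Set
LegalA G σ τ k =
  let as = proj₁ (play G σ τ k)
      bs = proj₂ (play G σ τ k)
  in ¬ (InE G (τ bs) as) × ¬ (InE G (τ bs) bs)

-- B's move in round k+1 is legal.
LegalB : ∀ (G : Graph) → StrategyB G → StrategyA G → ℕ → Set
LegalB G σ τ k =
  let as = proj₁ (play G σ τ k)
      bs = proj₂ (play G σ τ k)
      as′ = as ++ [ τ bs ]
  in ¬ (InE G (σ as′) as′) × ¬ (InE G (σ as′) bs)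

IsSymmetricStrategy : (G : Graph) → StrategyB G → Set
IsSymmetricStrategy G σ = ∀ (τ : StrategyA G) (i : ℕ) → 2 * i ≤ numEdges G →
  (∀ j → j < i → LegalA G σ τ j) →
  (∀ j → j < i → LegalB G σ τ j) × IsoSub G (proj₁ (play G σ τ i)) (proj₂ (play G σ τ i))

Symm : Graph → Set
Symm G = ∃ λ (σ : StrategyB G) → IsSymmetricStrategy G σ

-- Red opens with the edge 01; let uv (u < v) be Blue's answer and c the end of 01 off it
-- (c = 0 unless u = 0).  Red then grows a star at c whose leaves come in an order starting with the
-- other end of 01, then u and v.  While Red's graph is a star any two blue edges must meet, so a blue
-- edge at c would have to be cu or cv, which Red has already coloured.  The one exception, Blue
-- answering 0v in round 2 when u, v ∉ {0,1}, is met by Red closing the triangle 01u: Blue holds the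
-- path u v 0 but cannot close it, as 0u is red.  So Blue never touches c, yet after n - 1 rounds
-- (within the game, since K_n has at least 2(n - 1) edges for n ≥ 4) Red's star spans all vertices,
-- and so would Blue's isomorphic star, reaching c.

module Submission where

open import Defs
open import Data.Bool using (Bool; T; _∧_)
open import Data.Empty using (⊥; ⊥-elim)
open import Data.Fin using (Fin; zero; suc; toℕ)
open import Data.Fin.Permutation using (Permutation; transpose; _∘ₚ_; _⟨$⟩ʳ_; _⟨$⟩ˡ_; inverseˡ; inverseʳ)
open import Data.Fin.Properties using (_≟_; <-cmp; <⇒≢; toℕ-fromℕ<; toℕ-injective; toℕ<n)
open import Data.List using (List; []; _∷_; _++_; [_]; length; map; filterᵇ; allFin; tabulate; concatMap)
open import Data.List.Properties using (filter-++; filter-all; filter-some; length-++; length-map; length-tabulate)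
open import Data.List.Relation.Unary.All using (All)
open import Data.List.Relation.Unary.All.Properties using (map⁺; tabulate⁺)
open import Data.List.Relation.Unary.Any using (here; there)
import Data.List.Relation.Unary.Any as Any
open import Data.List.Relation.Unary.Any.Properties using (++⁺ˡ; ++⁺ʳ; ++⁻; singleton⁻)
open import Data.Nat using (ℕ; suc; NonZero; _+_; _*_; _≤_; _<_; _<?_; _≤?_; z≤n; s≤s; s≤s⁻¹)
open import Data.Nat.DivMod using (_mod_; m<n⇒m%n≡m)
open import Data.Nat.Properties
  using (<-irrefl; <-asym; <-≤-trans; <⇒≤; ≤-refl; ≤-trans; ≤-reflexive; n≮0; m≤n+m; m≤m+n; m≤n⇒m≤1+n;
         m<1+n⇒m<n∨m≡n; m≤n⇒m<n∨m≡n; +-mono-≤; *-monoʳ-≤; +-comm; +-identityʳ; module ≤-Reasoning)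
open import Data.Product using (∃-syntax; _×_; _,_; proj₁; proj₂)
open import Data.Product.Properties using (≡-dec)
open import Data.Sum using (_⊎_; inj₁; inj₂)
import Data.Sum as Sum
open import Data.Unit using (tt)
open import Function using (_∘_)
open import Function.Bundles using (Inverse; Equivalence)
open import Relation.Binary using (tri<; tri≈; tri>)
open import Relation.Binary.PropositionalEquality
  using (_≡_; _≢_; refl; sym; trans; cong; cong₂; subst; subst₂; module ≡-Reasoning)
open import Relation.Nullary using (¬_; yes; no; Dec)
open import Relation.Nullary.Decidable using (⌊_⌋; T?; _×-dec_)

pattern 0F = zero
pattern 1F = suc zero
pattern 2F = suc (suc zero)
pattern 3F = suc (suc (suc zero))

module EdgeLists (G : Graph) where

  private
    V = Fin (n G)

  Links : Edge G → V → V → Set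
  Links e x y = (ends G e ≡ (x , y)) ⊎ (ends G e ≡ (y , x))

  links-sym : ∀ {e x y} → Links e x y → Links e y x
  links-sym = Sum.swap

  links-distinct : ∀ {e x y} → Links e x y → x ≢ y
  links-distinct {(_ , _) , x<y , _} (inj₁ refl) refl = <-irrefl refl x<y
  links-distinct {(_ , _) , y<x , _} (inj₂ refl) refl = <-irrefl refl y<x

  links-match : ∀ {e x y a b} → Links e x y → Links e a b → (x ≡ a × y ≡ b) ⊎ (x ≡ b × y ≡ a)
  links-match {(_ , _) , _} (inj₁ refl) (inj₁ refl) = inj₁ (refl , refl)
  links-match {(_ , _) , _} (inj₁ refl) (inj₂ refl) = inj₂ (refl , refl)
  links-match {(_ , _) , _} (inj₂ refl) (inj₁ refl) = inj₂ (refl , refl)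
  links-match {(_ , _) , _} (inj₂ refl) (inj₂ refl) = inj₁ (refl , refl)

  links-unique : ∀ {e e′ x y} → Links e x y → Links e′ x y → ends G e ≡ ends G e′
  links-unique {(_ , _) , _} {(_ , _) , _} (inj₁ refl) (inj₁ refl) = refl
  links-unique {(_ , _) , lt , _} {(_ , _) , lt′ , _} (inj₁ refl) (inj₂ refl) = ⊥-elim (<-asym lt lt′)
  links-unique {(_ , _) , lt , _} {(_ , _) , lt′ , _} (inj₂ refl) (inj₁ refl) = ⊥-elim (<-asym lt lt′)
  links-unique {(_ , _) , _} {(_ , _) , _} (inj₂ refl) (inj₂ refl) = refl

  links-endpoint : ∀ {e a b x y} → ends G e ≡ (a , b) → Links e x y → x ≡ a ⊎ x ≡ b
  links-endpoint e≡ab (inj₁ e≡xy) = inj₁ (cong proj₁ (trans (sym e≡xy) e≡ab))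
  links-endpoint e≡ab (inj₂ e≡yx) = inj₂ (cong proj₂ (trans (sym e≡yx) e≡ab))

  joined-sym : ∀ {L x y} → Joined G L x y → Joined G L y x
  joined-sym = Any.map λ {e} → links-sym {e}

  joined-last : ∀ L {e x y} → Links e x y → Joined G (L ++ [ e ]) x y
  joined-last L l = ++⁺ʳ L (here l)

  joined-++-[]⁻ : ∀ L {e x y} → Joined G (L ++ [ e ]) x y → Joined G L x y ⊎ Links e x y
  joined-++-[]⁻ L j = Sum.map₂ singleton⁻ (++⁻ L j)

  joined⇒InE : ∀ {L e x y} → Joined G L x y → Links e x y → InE G e L
  joined⇒InE {e = e} j l = Any.map (λ {e′} → links-unique {e} {e′} l) j

  InE⇒joined : ∀ {L e x y} → InE G e L → Links e x y → Joined G L x y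
  InE⇒joined i l = Any.map (λ e≡e′ → Sum.map (trans (sym e≡e′)) (trans (sym e≡e′)) l) i

  StarAt : List (Edge G) → V → Set
  StarAt L c = ∀ x y → Joined G L x y → x ≡ c ⊎ y ≡ c

  Avoids : List (Edge G) → V → Set
  Avoids L c = ∀ x y → Joined G L x y → x ≢ c

  NoInducedP₃ : List (Edge G) → Set
  NoInducedP₃ L = ∀ x y z → Joined G L x y → Joined G L x z → y ≢ z → Joined G L y z

  clique⇒noInducedP₃ : ∀ {L} (S : V → Set) → (∀ x y → Joined G L x y → S x) →
                       (∀ x y → S x → S y → x ≢ y → Joined G L x y) → NoInducedP₃ L
  clique⇒noInducedP₃ S support complete x y z xy xz y≢z =
    complete y z (support y x (joined-sym xy)) (support z x (joined-sym xz)) y≢z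

  module _ {A B : List (Edge G)} (iso : IsoSub G A B) where

    private
      to from : V → V
      to = Inverse.to (proj₁ iso)
      from = Inverse.from (proj₁ iso)

      to-from : ∀ x → to (from x) ≡ x
      to-from x = Inverse.inverseˡ (proj₁ iso) refl

      from-injective : ∀ {x y} → from x ≡ from y → x ≡ y
      from-injective {x} {y} eq = trans (sym (to-from x)) (trans (cong to eq) (to-from y))

      forth : ∀ {x y} → Joined G A x y → Joined G B (to x) (to y)
      forth = Equivalence.to (proj₂ iso _ _)

      back : ∀ {x y} → Joined G B x y → Joined G A (from x) (from y)
      back {x} {y} j = Equivalence.from (proj₂ iso _ _) (subst₂ (Joined G B) (sym (to-from x)) (sym (to-from y)) j)

    iso-star-edges-meet : ∀ {c a b a′ b′} → StarAt A c → Joined G B a b → Joined G B a′ b′ →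
                          a ≢ a′ → a ≢ b′ → b ≢ a′ → b ≢ b′ → ⊥
    iso-star-edges-meet star j j′ a≢a′ a≢b′ b≢a′ b≢b′
      with star _ _ (back j) | star _ _ (back j′)
    ... | inj₁ p | inj₁ q = a≢a′ (from-injective (trans p (sym q)))
    ... | inj₁ p | inj₂ q = a≢b′ (from-injective (trans p (sym q)))
    ... | inj₂ p | inj₁ q = b≢a′ (from-injective (trans p (sym q)))
    ... | inj₂ p | inj₂ q = b≢b′ (from-injective (trans p (sym q)))

    iso-noInducedP₃ : NoInducedP₃ A → NoInducedP₃ B
    iso-noInducedP₃ closed x y z xy xz y≢z =
      subst₂ (Joined G B) (to-from y) (to-from z)
        (forth (closed _ _ _ (back xy) (back xz) (y≢z ∘ from-injective)))

    -- to c is the centre of a spanning star of B, so c is either that centre or one of its leaves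
    iso-spanning-star-meets : ∀ {c d} → d ≢ c → (∀ x → x ≢ c → Joined G A c x) → ¬ Avoids B c
    iso-spanning-star-meets {c} {d} d≢c spans avoids with from c ≟ c
    ... | no from-c≢c =
      avoids c (to c) (joined-sym (subst (Joined G B (to c)) (to-from c) (forth (spans _ from-c≢c)))) refl
    ... | yes from-c≡c =
      avoids c (to d) (subst (λ z → Joined G B z (to d)) to-c≡c (forth (spans d d≢c))) refl
      where
      to-c≡c : to c ≡ c
      to-c≡c = trans (cong to (sym from-c≡c)) (to-from c)

K-adjacent : ∀ {k} {x y : Fin k} → x ≢ y → T (adj (K k) x y)
K-adjacent {x = x} {y} x≢y with x ≟ y
... | yes x≡y = ⊥-elim (x≢y x≡y)
... | no _ = tt

K-edge : ∀ {k} {x y : Fin k} → toℕ x < toℕ y → Edge (K k)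
K-edge {x = x} {y} x<y = (x , y) , x<y , K-adjacent (<⇒≢ x<y)

-- the edge xy of K k; d is a junk value for x ≡ y
linkOr : ∀ {k} → Edge (K k) → Fin k → Fin k → Edge (K k)
linkOr d x y with <-cmp x y
... | tri< x<y _ _ = K-edge x<y
... | tri≈ _ _ _ = d
... | tri> _ _ y<x = K-edge y<x

module _ {k} {d : Edge (K k)} where
  open EdgeLists (K k)

  linkOr-links : ∀ {x y} → x ≢ y → Links (linkOr d x y) x y
  linkOr-links {x} {y} x≢y with <-cmp x y
  ... | tri< _ _ _ = inj₁ refl
  ... | tri≈ _ x≡y _ = ⊥-elim (x≢y x≡y)
  ... | tri> _ _ _ = inj₂ refl

  linkOr-ends : ∀ {x y} → toℕ x < toℕ y → ends (K k) (linkOr d x y) ≡ (x , y)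
  linkOr-ends {x} {y} x<y with <-cmp x y
  ... | tri< _ _ _ = refl
  ... | tri≈ x≮y _ _ = ⊥-elim (x≮y x<y)
  ... | tri> x≮y _ _ = ⊥-elim (x≮y x<y)

module _ {A : Set} (p : A → Bool) where

  length-filterᵇ-++ : ∀ xs ys → length (filterᵇ p (xs ++ ys)) ≡ length (filterᵇ p xs) + length (filterᵇ p ys)
  length-filterᵇ-++ xs ys = trans (cong length (filter-++ (T? ∘ p) xs ys)) (length-++ (filterᵇ p xs))

  length-filterᵇ-++-all : ∀ ys {xs} → All (T ∘ p) xs → length xs ≤ length (filterᵇ p (ys ++ xs))
  length-filterᵇ-++-all ys {xs} all = begin
    length xs                                       ≡⟨ cong length (filter-all (T? ∘ p) all) ⟨
    length (filterᵇ p xs)                           ≤⟨ m≤n+m _ _ ⟩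
    length (filterᵇ p ys) + length (filterᵇ p xs)   ≡⟨ length-filterᵇ-++ ys xs ⟨
    length (filterᵇ p (ys ++ xs))                   ∎
    where open ≤-Reasoning

numEdges-K-lower-bound : ∀ m → 2 * (3 + m) ≤ numEdges (K (4 + m))
numEdges-K-lower-bound m = begin
  2 * (3 + m)                                  ≡⟨ cong ((3 + m) +_) (trans (+-identityʳ (3 + m)) (+-comm 1 (2 + m))) ⟩
  (3 + m) + ((2 + m) + 1)                      ≤⟨ +-mono-≤ row₀ (+-mono-≤ row₁ (≤-trans row₂ (m≤m+n _ _))) ⟩
  count (row 0F) + (count (row 1F) + (count (row 2F) + count rest))
    ≡⟨ cong (count (row 0F) +_) (trans (length-filterᵇ-++ ok (row 1F) _)
                                        (cong (count (row 1F) +_) (length-filterᵇ-++ ok (row 2F) rest))) ⟨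
  count (row 0F) + count (row 1F ++ (row 2F ++ rest))   ≡⟨ length-filterᵇ-++ ok (row 0F) _ ⟨
  numEdges (K (4 + m))                         ∎
  where
  open ≤-Reasoning
  N : ℕ
  N = 4 + m
  -- the filter of numEdges, which is local to its definition
  ok : Fin N × Fin N → Bool
  ok (u , v) = ⌊ toℕ u <? toℕ v ⌋ ∧ adj (K N) u v
  count : List (Fin N × Fin N) → ℕ
  count = length ∘ filterᵇ ok
  row : Fin N → List (Fin N × Fin N)
  row u = map (u ,_) (allFin N)
  rest : List (Fin N × Fin N)
  rest = concatMap row (tabulate λ (i : Fin (1 + m)) → suc (suc (suc i)))
  length-row-tail : ∀ u {k} (f : Fin k → Fin N) → length (map (u ,_) (tabulate f)) ≡ k
  length-row-tail u f = trans (length-map (u ,_) (tabulate f)) (length-tabulate f)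
  above₀ : Fin (3 + m) → Fin N
  above₀ i = suc i
  above₁ : Fin (2 + m) → Fin N
  above₁ i = suc (suc i)
  row₀ : 3 + m ≤ count (row 0F)
  row₀ = ≤-trans (≤-reflexive (sym (length-row-tail 0F above₀)))
                 (length-filterᵇ-++-all ok [ (0F , 0F) ] {map (0F ,_) (tabulate above₀)}
                    (map⁺ (tabulate⁺ {f = above₀} λ _ → tt)))
  row₁ : 2 + m ≤ count (row 1F)
  row₁ = ≤-trans (≤-reflexive (sym (length-row-tail 1F above₁)))
                 (length-filterᵇ-++-all ok ((1F , 0F) ∷ [ (1F , 1F) ]) {map (1F ,_) (tabulate above₁)}
                    (map⁺ (tabulate⁺ {f = above₁} λ _ → tt)))
  row₂ : 1 ≤ count (row 2F)
  row₂ = filter-some (T? ∘ ok) {row 2F} (there (there (there (here tt))))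

toℕ-mod : ∀ {j k} .{{_ : NonZero k}} → j < k → toℕ (j mod k) ≡ j
toℕ-mod j<k = trans (toℕ-fromℕ< _) (m<n⇒m%n≡m j<k)

transpose-fixes : ∀ {k} {i j x : Fin k} → x ≢ i → x ≢ j → transpose i j ⟨$⟩ʳ x ≡ x
transpose-fixes {i = i} {j} {x} x≢i x≢j with x ≟ i
... | yes x≡i = ⊥-elim (x≢i x≡i)
... | no _ with x ≟ j
...   | yes x≡j = ⊥-elim (x≢j x≡j)
...   | no _ = refl

blue-after-two : ∀ {G} (σ : StrategyB G) (τ : StrategyA G) k →
                 ∃[ T ] proj₂ (play G σ τ (2 + k)) ≡ proj₂ (play G σ τ 2) ++ T × length T ≡ k
blue-after-two σ τ 0 = [] , refl , refl
blue-after-two {G} σ τ (suc k) with blue-after-two σ τ k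
... | T , blue≡ , |T|≡k =
  T ++ [ b ] , cong (_++ [ b ]) blue≡ , trans (length-++ T) (trans (+-comm (length T) 1) (cong suc |T|≡k))
  where
  b : Edge G
  b = σ (proj₁ (play G σ τ (3 + k)))

below-suc : ∀ {P : ℕ → Set} {k} → (∀ j → j < k → P j) → P k → ∀ j → j < suc k → P j
below-suc below at j j<1+k with m<1+n⇒m<n∨m≡n j<1+k
... | inj₁ j<k = below j j<k
... | inj₂ refl = at

module Game (m : ℕ) where

  N : ℕ
  N = 4 + m

  private
    V = Fin N

  open EdgeLists (K N)

  e01 : Edge (K N)
  e01 = K-edge {x = 0F} {1F} (s≤s z≤n)

  link : V → V → Edge (K N)
  link = linkOr e01

  lower upper : Edge (K N) → V
  lower f = proj₁ (ends (K N) f)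
  upper f = proj₂ (ends (K N) f)

  centre : V → V
  centre 0F = 1F
  centre (suc _) = 0F

  -- leaf u v j = ρ j: ρ 0 is centre u, ρ 1 the other end of 01, and u, v come right after
  spokeOrder : V → V → Permutation N N
  spokeOrder 0F v = transpose 2F v ∘ₚ transpose 0F 1F
  spokeOrder 1F v = transpose 2F v
  spokeOrder (suc (suc u)) v = transpose 3F v ∘ₚ transpose 2F (suc (suc u))

  leaf : V → V → ℕ → V
  leaf u v j = spokeOrder u v ⟨$⟩ʳ (j mod N)

  leaf-injective : ∀ u v {j j′} → j < N → j′ < N → leaf u v j ≡ leaf u v j′ → j ≡ j′
  leaf-injective u v {j} {j′} j<N j′<N eq = begin
    j                 ≡⟨ toℕ-mod j<N ⟨
    toℕ (j mod N)     ≡⟨ cong toℕ (trans (sym (inverseˡ ρ)) (trans (cong (ρ ⟨$⟩ˡ_) eq) (inverseˡ ρ))) ⟩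
    toℕ (j′ mod N)    ≡⟨ toℕ-mod j′<N ⟩
    j′                ∎
    where
    open ≡-Reasoning
    ρ : Permutation N N
    ρ = spokeOrder u v

  leaf-surjective : ∀ u v x → ∃[ j ] j < N × leaf u v j ≡ x
  leaf-surjective u v x =
    toℕ i , toℕ<n i , trans (cong (ρ ⟨$⟩ʳ_) (toℕ-injective (toℕ-mod (toℕ<n i)))) (inverseʳ ρ)
    where
    ρ : Permutation N N
    ρ = spokeOrder u v
    i : V
    i = ρ ⟨$⟩ˡ x

  data Opening : V → V → Set where
    at0   : ∀ w → Opening 0F (suc (suc w))
    at1   : ∀ w → Opening 1F (suc (suc w))
    apart : ∀ w w′ → _≢_ {A = V} (suc (suc w)) (suc (suc (suc w′))) → Opening (suc (suc w)) (suc (suc (suc w′)))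

  opening : ∀ {u v} → toℕ u < toℕ v → (u , v) ≢ (0F , 1F) → Opening u v
  opening {0F} {1F} _ ≢01 = ⊥-elim (≢01 refl)
  opening {0F} {suc (suc w)} _ _ = at0 w
  opening {1F} {suc (suc w)} _ _ = at1 w
  opening {1F} {1F} (s≤s ()) _
  opening {suc (suc w)} {suc (suc (suc w′))} u<v _ = apart w w′ (<⇒≢ u<v)
  opening {suc (suc w)} {2F} (s≤s (s≤s ())) _
  opening {suc (suc w)} {1F} (s≤s ()) _

  module _ {u v : V} where

    centre-is-leaf₀ : Opening u v → leaf u v 0 ≡ centre u
    centre-is-leaf₀ (at0 _) = refl
    centre-is-leaf₀ (at1 _) = refl
    centre-is-leaf₀ (apart _ _ _) = refl

    e01-is-spoke₁ : Opening u v → Links e01 (centre u) (leaf u v 1)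
    e01-is-spoke₁ (at0 _) = inj₂ refl
    e01-is-spoke₁ (at1 _) = inj₁ refl
    e01-is-spoke₁ (apart _ _ _) = inj₁ refl

    centre≢lower : Opening u v → centre u ≢ u
    centre≢lower (at0 _) ()
    centre≢lower (at1 _) ()
    centre≢lower (apart _ _ _) ()

    centre≢upper : Opening u v → centre u ≢ v
    centre≢upper (at0 _) ()
    centre≢upper (at1 _) ()
    centre≢upper (apart _ _ _) ()

    lower-is-early : Opening u v → u ≡ leaf u v 1 ⊎ u ≡ leaf u v 2
    lower-is-early (at0 _) = inj₁ refl
    lower-is-early (at1 _) = inj₁ refl
    lower-is-early (apart _ _ _) = inj₂ refl

    upper-is-early : Opening u v → v ≡ leaf u v 2 ⊎ (2 ≤ toℕ u × v ≡ leaf u v 3)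
    upper-is-early (at0 _) = inj₁ refl
    upper-is-early (at1 _) = inj₁ refl
    upper-is-early (apart _ _ u≢v) =
      inj₂ (s≤s (s≤s z≤n) , sym (transpose-fixes {i = 2F} (λ ()) (λ v≡u → u≢v (sym v≡u))))

    apart-leaf₂ : 2 ≤ toℕ u → Opening u v → leaf u v 2 ≡ u
    apart-leaf₂ _ (apart _ _ _) = refl
    apart-leaf₂ () (at0 _)
    apart-leaf₂ (s≤s ()) (at1 _)

  apart-centre : ∀ {u} → 2 ≤ toℕ u → centre u ≡ 0F
  apart-centre {suc _} _ = refl

  spoke : Edge (K N) → ℕ → Edge (K N)
  spoke f j = link (centre (lower f)) (leaf (lower f) (upper f) j)

  Triggers : Edge (K N) → Edge (K N) → Set
  Triggers f g = 2 ≤ toℕ (lower f) × ends (K N) g ≡ (0F , upper f)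

  triggers? : ∀ f g → Dec (Triggers f g)
  triggers? f g = (2 ≤? toℕ (lower f)) ×-dec ≡-dec _≟_ _≟_ (ends (K N) g) (0F , upper f)

  redStrategy : StrategyA (K N)
  redStrategy [] = e01
  redStrategy (f ∷ []) = spoke f 2
  redStrategy (f ∷ g ∷ rest) with triggers? f g
  ... | yes _ = link 1F (lower f)
  ... | no _ = spoke f (3 + length rest)

  redStrategy-untriggered : ∀ {f g} → ¬ Triggers f g → ∀ T → redStrategy (f ∷ g ∷ T) ≡ spoke f (3 + length T)
  redStrategy-untriggered {f} {g} ¬t T with triggers? f g
  ... | yes t = ⊥-elim (¬t t)
  ... | no _ = refl

  redStrategy-triggered : ∀ {f g} → Triggers f g → ∀ T → redStrategy (f ∷ g ∷ T) ≡ link 1F (lower f)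
  redStrategy-triggered {f} {g} t T with triggers? f g
  ... | yes _ = refl
  ... | no ¬t = ⊥-elim (¬t t)

  module Against (σ : StrategyB (K N)) (symmetric : IsSymmetricStrategy (K N) σ) where

    red blue : ℕ → List (Edge (K N))
    red k = proj₁ (play (K N) σ redStrategy k)
    blue k = proj₂ (play (K N) σ redStrategy k)

    blueMove : ℕ → Edge (K N)
    blueMove k = σ (red (suc k))

    RedLegalBelow : ℕ → Set
    RedLegalBelow k = ∀ j → j < k → LegalA (K N) σ redStrategy j

    BlueResponse : ℕ → Set
    BlueResponse k = (∀ j → j < k → LegalB (K N) σ redStrategy j) × IsoSub (K N) (red k) (blue k)

    symmetric-at : ∀ k → k ≤ 3 + m → RedLegalBelow k → BlueResponse k
    symmetric-at k k≤3+m = symmetric redStrategy k (≤-trans (*-monoʳ-≤ 2 k≤3+m) (numEdges-K-lower-bound m))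

    red-legal₀ : LegalA (K N) σ redStrategy 0
    red-legal₀ = (λ ()) , (λ ())

    f₁ g₂ : Edge (K N)
    f₁ = σ [ e01 ]
    g₂ = σ (e01 ∷ spoke f₁ 2 ∷ [])

    u v c : V
    u = lower f₁
    v = upper f₁
    c = centre u

    ℓ : ℕ → V
    ℓ = leaf u v

    f₁-opening : Opening u v
    f₁-opening = opening (proj₁ (proj₂ f₁)) λ f₁≡01 → proj₁ (blue-legal₀ 0 (s≤s z≤n)) (here f₁≡01)
      where
      blue-legal₀ : ∀ j → j < 1 → LegalB (K N) σ redStrategy j
      blue-legal₀ = proj₁ (symmetric-at 1 (s≤s z≤n) (below-suc (λ _ ()) red-legal₀))

    leaf≢centre : ∀ {j} → 1 ≤ j → j < N → ℓ j ≢ c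
    leaf≢centre {suc j} _ j<N ℓj≡c
      with leaf-injective u v j<N (s≤s z≤n) (trans ℓj≡c (sym (centre-is-leaf₀ f₁-opening)))
    ... | ()

    f₁-blue : ∀ k → Joined (K N) (blue (suc k)) u v
    f₁-blue 0 = here (inj₁ refl)
    f₁-blue (suc k) = ++⁺ˡ (f₁-blue k)

    module StarCase (¬triggered : ¬ Triggers f₁ g₂) where

      red-move : ∀ k → 1 ≤ k → redStrategy (blue k) ≡ spoke f₁ (suc k)
      red-move 1 _ = refl
      red-move (suc (suc k)) _ with blue-after-two σ redStrategy k
      ... | T , blue≡ , |T|≡k = begin
        redStrategy (blue (2 + k))         ≡⟨ cong redStrategy blue≡ ⟩
        redStrategy (f₁ ∷ g₂ ∷ T)          ≡⟨ redStrategy-untriggered ¬triggered T ⟩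
        spoke f₁ (3 + length T)            ≡⟨ cong (λ i → spoke f₁ (3 + i)) |T|≡k ⟩
        spoke f₁ (3 + k)                   ∎
        where open ≡-Reasoning

      red-move-links : ∀ k → suc k < N → Links (redStrategy (blue k)) c (ℓ (suc k))
      red-move-links 0 _ = e01-is-spoke₁ f₁-opening
      red-move-links (suc k) 2+k<N rewrite red-move (suc k) (s≤s z≤n) =
        linkOr-links λ c≡ℓ → leaf≢centre (s≤s z≤n) 2+k<N (sym c≡ℓ)

      Spoke : V → V → ℕ → Set
      Spoke x y j = (x ≡ c × y ≡ ℓ j) ⊎ (x ≡ ℓ j × y ≡ c)

      red-spokes : ∀ k → k < N → ∀ {x y} → Joined (K N) (red k) x y → ∃[ j ] 1 ≤ j × j ≤ k × Spoke x y j
      red-spokes (suc k) 1+k<N j with joined-++-[]⁻ (red k) j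
      ... | inj₂ new = suc k , s≤s z≤n , ≤-refl , links-match {redStrategy (blue k)} new (red-move-links k 1+k<N)
      ... | inj₁ old with red-spokes k (<⇒≤ 1+k<N) old
      ...   | i , 1≤i , i≤k , xy-spoke = i , 1≤i , m≤n⇒m≤1+n i≤k , xy-spoke

      spokes-red : ∀ k → k < N → ∀ {j} → 1 ≤ j → j ≤ k → Joined (K N) (red k) c (ℓ j)
      spokes-red 0 _ (s≤s _) ()
      spokes-red (suc k) 1+k<N 1≤j j≤1+k with m≤n⇒m<n∨m≡n j≤1+k
      ... | inj₁ j<1+k = ++⁺ˡ (spokes-red k (<⇒≤ 1+k<N) 1≤j (s≤s⁻¹ j<1+k))
      ... | inj₂ refl = joined-last (red k) (red-move-links k 1+k<N)

      red-star : ∀ k → k < N → StarAt (red k) c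
      red-star k k<N x y j with red-spokes k k<N j
      ... | _ , _ , _ , inj₁ (x≡c , _) = inj₁ x≡c
      ... | _ , _ , _ , inj₂ (_ , y≡c) = inj₂ y≡c

      red-move-fresh : ∀ k → suc k < N → ¬ Joined (K N) (red k) c (ℓ (suc k))
      red-move-fresh k 1+k<N j with red-spokes k (<⇒≤ 1+k<N) j
      ... | i , 1≤i , i≤k , inj₁ (_ , ℓ1+k≡ℓi)
        with leaf-injective u v 1+k<N (<-≤-trans (s≤s i≤k) (<⇒≤ 1+k<N)) ℓ1+k≡ℓi
      ...   | refl = <-irrefl refl i≤k
      red-move-fresh k 1+k<N j | i , 1≤i , i≤k , inj₂ (c≡ℓi , _) =
        leaf≢centre 1≤i (<-≤-trans (s≤s i≤k) (<⇒≤ 1+k<N)) (sym c≡ℓi)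

      blue-cannot-repaint : ∀ k → 2 + k < N → LegalB (K N) σ redStrategy (suc k) →
                            ∀ {j y} → 1 ≤ j → j ≤ 2 + k → y ≡ ℓ j → ¬ Links (blueMove (suc k)) c y
      blue-cannot-repaint k 2+k<N legal 1≤j j≤2+k refl l =
        proj₁ legal (joined⇒InE {e = blueMove (suc k)} (spokes-red (2 + k) 2+k<N 1≤j j≤2+k) l)

      g₂-triggers : 2 ≤ toℕ u → Links g₂ c v → Triggers f₁ g₂
      g₂-triggers 2≤u (inj₁ g₂≡cv) = 2≤u , trans g₂≡cv (cong (_, v) (apart-centre 2≤u))
      g₂-triggers 2≤u (inj₂ g₂≡vc) = ⊥-elim (n≮0 (subst (λ z → toℕ v < toℕ z) (apart-centre 2≤u) v<c))
        where
        v<c : toℕ v < toℕ c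
        v<c = subst (λ p → toℕ (proj₁ p) < toℕ (proj₂ p)) g₂≡vc (proj₁ (proj₂ g₂))

      blue-avoids-third-spoke : ∀ k → 2 + k < N → LegalB (K N) σ redStrategy (suc k) →
                                2 ≤ toℕ u → v ≡ ℓ 3 → ∀ {y} → y ≡ v → ¬ Links (blueMove (suc k)) c y
      blue-avoids-third-spoke 0 _ _ 2≤u _ refl l = ¬triggered (g₂-triggers 2≤u l)
      blue-avoids-third-spoke (suc k) 3+k<N legal _ v≡ℓ₃ y≡v =
        blue-cannot-repaint (suc k) 3+k<N legal (s≤s z≤n) (s≤s (s≤s (s≤s z≤n))) (trans y≡v v≡ℓ₃)

      blue-move-avoids : ∀ k → suc k < N → LegalB (K N) σ redStrategy k →
                         IsoSub (K N) (red (suc k)) (blue (suc k)) → ∀ {y} → ¬ Links (blueMove k) c y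
      blue-move-avoids 0 _ _ _ l with links-match {f₁} l (inj₁ refl)
      ... | inj₁ (c≡u , _) = centre≢lower f₁-opening c≡u
      ... | inj₂ (c≡v , _) = centre≢upper f₁-opening c≡v
      blue-move-avoids (suc k) 2+k<N legal iso {y} l with y ≟ u | y ≟ v
      ... | yes y≡u | _ with lower-is-early f₁-opening
      ...   | inj₁ u≡ℓ₁ = blue-cannot-repaint k 2+k<N legal (s≤s z≤n) (s≤s z≤n) (trans y≡u u≡ℓ₁) l
      ...   | inj₂ u≡ℓ₂ = blue-cannot-repaint k 2+k<N legal (s≤s z≤n) (s≤s (s≤s z≤n)) (trans y≡u u≡ℓ₂) l
      blue-move-avoids (suc k) 2+k<N legal _ {y} l | no _ | yes y≡v with upper-is-early f₁-opening
      ...   | inj₁ v≡ℓ₂ = blue-cannot-repaint k 2+k<N legal (s≤s z≤n) (s≤s (s≤s z≤n)) (trans y≡v v≡ℓ₂) l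
      ...   | inj₂ (2≤u , v≡ℓ₃) = blue-avoids-third-spoke k 2+k<N legal 2≤u v≡ℓ₃ y≡v l
      blue-move-avoids (suc k) 2+k<N legal iso {y} l | no y≢u | no y≢v =
        iso-star-edges-meet iso (red-star (2 + k) 2+k<N) (f₁-blue (suc k)) (joined-last (blue (suc k)) l)
          (λ u≡c → centre≢lower f₁-opening (sym u≡c)) (λ u≡y → y≢u (sym u≡y))
          (λ v≡c → centre≢upper f₁-opening (sym v≡c)) (λ v≡y → y≢v (sym v≡y))

      red-legal : ∀ k → suc k < N → Avoids (blue k) c → LegalA (K N) σ redStrategy k
      red-legal k 1+k<N avoids =
        (λ repeated → red-move-fresh k 1+k<N (InE⇒joined {e = move} repeated move-links)) ,
        (λ stolen → avoids c (ℓ (suc k)) (InE⇒joined {e = move} stolen move-links) refl)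
        where
        move : Edge (K N)
        move = redStrategy (blue k)
        move-links : Links move c (ℓ (suc k))
        move-links = red-move-links k 1+k<N

      star-rounds : ∀ k → k < N → RedLegalBelow k × Avoids (blue k) c
      star-rounds 0 _ = (λ _ ()) , (λ _ _ ())
      star-rounds (suc k) 1+k<N = legal , avoids′
        where
        previous : RedLegalBelow k × Avoids (blue k) c
        previous = star-rounds k (<⇒≤ 1+k<N)
        legal : RedLegalBelow (suc k)
        legal = below-suc (proj₁ previous) (red-legal k 1+k<N (proj₂ previous))
        response : BlueResponse (suc k)
        response = symmetric-at (suc k) (s≤s⁻¹ 1+k<N) legal
        avoids′ : Avoids (blue (suc k)) c
        avoids′ x y j with joined-++-[]⁻ (blue k) j
        ... | inj₁ old = proj₂ previous x y old
        ... | inj₂ new = λ x≡c → blue-move-avoids k 1+k<N (proj₁ response k ≤-refl) (proj₂ response)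
                                   (subst (λ z → Links (blueMove k) z y) x≡c new)

      contradiction : ⊥
      contradiction = iso-spanning-star-meets (proj₂ (symmetric-at (3 + m) ≤-refl legal))
                        (leaf≢centre (s≤s z≤n) (s≤s (s≤s z≤n))) spans avoids
        where
        legal : RedLegalBelow (3 + m)
        legal = proj₁ (star-rounds (3 + m) ≤-refl)
        avoids : Avoids (blue (3 + m)) c
        avoids = proj₂ (star-rounds (3 + m) ≤-refl)
        spans : ∀ x → x ≢ c → Joined (K N) (red (3 + m)) c x
        spans x x≢c with leaf-surjective u v x
        ... | 0 , _ , ℓ₀≡x = ⊥-elim (x≢c (trans (sym ℓ₀≡x) (centre-is-leaf₀ f₁-opening)))
        ... | suc j , j<N , ℓj≡x = subst (Joined (K N) (red (3 + m)) c) ℓj≡x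
                                     (spokes-red (3 + m) ≤-refl (s≤s z≤n) (s≤s⁻¹ j<N))

    module TriangleCase (triggered : Triggers f₁ g₂) where

      u≥2 : 2 ≤ toℕ u
      u≥2 = proj₁ triggered

      u≢0 : u ≢ 0F
      u≢0 u≡0 with subst (λ z → 2 ≤ toℕ z) u≡0 u≥2
      ... | ()

      u≢1 : u ≢ 1F
      u≢1 u≡1 with subst (λ z → 2 ≤ toℕ z) u≡1 u≥2
      ... | s≤s ()

      v≢0 : v ≢ 0F
      v≢0 v≡0 = n≮0 (subst (λ z → toℕ u < toℕ z) v≡0 (proj₁ (proj₂ f₁)))

      e₂ e₃ : Edge (K N)
      e₂ = spoke f₁ 2
      e₃ = redStrategy (f₁ ∷ g₂ ∷ [])

      e₂-ends : ends (K N) e₂ ≡ (0F , u)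
      e₂-ends = trans (cong₂ (λ a b → ends (K N) (link a b)) (apart-centre u≥2) (apart-leaf₂ u≥2 f₁-opening))
                      (linkOr-ends (≤-trans (s≤s z≤n) u≥2))

      e₃-ends : ends (K N) e₃ ≡ (1F , u)
      e₃-ends = trans (cong (ends (K N)) (redStrategy-triggered triggered [])) (linkOr-ends u≥2)

      red-legal₃ : RedLegalBelow 3
      red-legal₃ 0 _ = red-legal₀
      red-legal₃ 1 _ = (λ { (here p) → u≢1 (cong proj₂ (trans (sym e₂-ends) p)) })
                     , (λ { (here p) → u≢0 (sym (cong proj₁ (trans (sym e₂-ends) p))) })
      red-legal₃ 2 _ = (λ { (here p) → 0≢1 (cong proj₁ (trans (sym p) e₃-ends))
                          ; (there (here p)) → 0≢1 (cong proj₁ (trans (sym (trans p e₂-ends)) e₃-ends)) })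
                     , (λ { (here p) → u≢1 (cong proj₁ (trans (sym p) e₃-ends))
                          ; (there (here p)) → 0≢1 (cong proj₁ (trans (sym (trans p (proj₂ triggered))) e₃-ends)) })
        where
        0≢1 : 0F ≢ 1F
        0≢1 ()
      red-legal₃ (suc (suc (suc _))) (s≤s (s≤s (s≤s ())))

      OnTriangle : V → Set
      OnTriangle x = x ≡ 0F ⊎ x ≡ 1F ⊎ x ≡ u

      red₃-support : ∀ x y → Joined (K N) (red 3) x y → OnTriangle x
      red₃-support x y (here l) = Sum.map₂ inj₁ (links-endpoint {e01} refl l)
      red₃-support x y (there (here l)) = Sum.map₂ inj₂ (links-endpoint {e₂} e₂-ends l)
      red₃-support x y (there (there (here l))) = inj₂ (links-endpoint {e₃} e₃-ends l)

      red₃-complete : ∀ x y → OnTriangle x → OnTriangle y → x ≢ y → Joined (K N) (red 3) x y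
      red₃-complete _ _ (inj₁ refl) (inj₁ refl) x≢y = ⊥-elim (x≢y refl)
      red₃-complete _ _ (inj₁ refl) (inj₂ (inj₁ refl)) _ = here (inj₁ refl)
      red₃-complete _ _ (inj₁ refl) (inj₂ (inj₂ refl)) _ = there (here (inj₁ e₂-ends))
      red₃-complete _ _ (inj₂ (inj₁ refl)) (inj₁ refl) _ = here (inj₂ refl)
      red₃-complete _ _ (inj₂ (inj₁ refl)) (inj₂ (inj₁ refl)) x≢y = ⊥-elim (x≢y refl)
      red₃-complete _ _ (inj₂ (inj₁ refl)) (inj₂ (inj₂ refl)) _ = there (there (here (inj₁ e₃-ends)))
      red₃-complete _ _ (inj₂ (inj₂ refl)) (inj₁ refl) _ = there (here (inj₂ e₂-ends))
      red₃-complete _ _ (inj₂ (inj₂ refl)) (inj₂ (inj₁ refl)) _ = there (there (here (inj₂ e₃-ends)))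
      red₃-complete _ _ (inj₂ (inj₂ refl)) (inj₂ (inj₂ refl)) x≢y = ⊥-elim (x≢y refl)

      response : BlueResponse 3
      response = symmetric-at 3 (s≤s (s≤s (s≤s z≤n))) red-legal₃

      blue₃-closed : NoInducedP₃ (blue 3)
      blue₃-closed = iso-noInducedP₃ (proj₂ response) (clique⇒noInducedP₃ OnTriangle red₃-support red₃-complete)

      blue₃-lacks-u0 : ¬ Joined (K N) (blue 3) u 0F
      blue₃-lacks-u0 (here l) =
        Sum.[ (λ (_ , 0≡v) → v≢0 (sym 0≡v)) , (λ (_ , 0≡u) → u≢0 (sym 0≡u)) ]′ (links-match {f₁} l (inj₁ refl))
      blue₃-lacks-u0 (there (here l)) =
        Sum.[ (λ (u≡0 , _) → u≢0 u≡0) , (λ (u≡v , _) → links-distinct {f₁} (inj₁ refl) u≡v) ]′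
          (links-match {g₂} l (inj₁ (proj₂ triggered)))
      blue₃-lacks-u0 (there (there (here l))) =
        proj₁ (proj₁ response 2 ≤-refl) (joined⇒InE {e = blueMove 2} (there (here (inj₂ e₂-ends))) l)

      contradiction : ⊥
      contradiction =
        blue₃-lacks-u0 (blue₃-closed v u 0F (here (inj₂ refl)) (there (here (inj₂ (proj₂ triggered)))) u≢0)

    σ-not-symmetric : ⊥
    σ-not-symmetric with triggers? f₁ g₂
    ... | yes triggered = TriangleCase.contradiction triggered
    ... | no ¬triggered = StarCase.contradiction ¬triggered

theorem5 : ∀ (n : ℕ) → 4 ≤ n → ¬ Symm (K n)
theorem5 (suc (suc (suc (suc m)))) (s≤s (s≤s (s≤s (s≤s z≤n)))) (σ , symmetric) =
  Game.Against.σ-not-symmetric m σ symmetric
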